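{- Let $n,m$ be positive integers. (i) If $n>m$, then $b_{n+m}-b_{n-m}=2c_nB_m$; (ii) If $n\leq m$, then $b_{n+m}-b_{m-n+1}=2c_nB_m$.
   Context: The balancing numbers $B_k$ ($k\ge 0$) are defined by $B_0=0$, $B_1=1$, $B_{k+1}=6B_k-B_{k-1}$ for $k\ge1$. The cobalancing numbers $b_k$ ($k\ge1$) are defined by $b_1=0$, $b_2=2$, $b_{k+1}=6b_k-b_{k-1}+2$ for $k\ge2$. The Lucas-cobalancing numbers $c_k$ ($k\ge1$) are defined by $c_1=1$, $c_2=7$, $c_{k+1}=6c_k-c_{k-1}$ for $k\ge2$. -}

module Defs where

open import Data.Nat using (ℕ; zero; suc)
open import Data.Integer using (ℤ; +_; _+_; _-_; _*_)

B : ℕ → ℤ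
B zero = + 0
B (suc zero) = + 1
B (suc (suc k)) = + 6 * B (suc k) - B k

-- Cobalancing numbers b k for k ≥ 1: b 1 = 0, b 2 = 2, b (k+1) = 6 b k - b (k-1) + 2.
-- (The value at index 0 is a dummy, never used for k ≥ 1; we set b 0 = 0.)
b : ℕ → ℤ
b zero = + 0
b (suc zero) = + 0
b (suc (suc zero)) = + 2
b (suc (suc (suc k))) = + 6 * b (suc (suc k)) - b (suc k) + + 2

-- Lucas-cobalancing numbers c k for k ≥ 1: c 1 = 1, c 2 = 7, c (k+1) = 6 c k - c (k-1).
-- (Dummy value c 0 = 0, never used for k ≥ 1.)
c : ℕ → ℤ
c zero = + 0
c (suc zero) = + 1
c (suc (suc zero)) = + 7
c (suc (suc (suc k))) = + 6 * c (suc (suc k)) - c (suc k)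

module Submission where

-- Put D k = 2 b k + 1.  Then D 0 = D 1 = 1 and D satisfies the
-- balancing recurrence x (k+2) = 6 x (k+1) - x k, like B and (from index 1) c.
-- The theorem is a statement about differences of D, and follows from:
--   * a uniqueness principle: two recurrent sequences agreeing at 0 and 1 agree;
--   * the "even difference" identity, valid for every recurrent X:
--       X (k + m) - X (k - m) = B m * (X (k + 1) - X (k - 1)),
--     where X (k + 1) - X (k - 1) is written as Δ X k = 2 (X (k + 1) - 3 X k)
--     so that it makes sense at k = 0 as well;
--   * Δ D n = 4 c n for n ≥ 1 (both sides are recurrent in n).
-- Part (i) is the even difference of D with centre n and half-length m.
-- Part (ii) concerns the odd difference D (a + 2n - 1) - D a with a = m - n + 1;
-- as a function of a it is recurrent, as is 4 c n B (a + n - 1), and the two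
-- agree at a = 0 and a = 1 by the even identity together with D 0 = D 1.
-- Halving the D-identities gives the statements about b.

open import Defs
open import Data.Nat using (ℕ; _≤_; _<_; _∸_; zero; suc; s≤s; z≤n) renaming (_+_ to _+ℕ_)
open import Data.Integer using (ℤ; +_; _-_; _*_; _+_)
open import Data.Product using (_×_; _,_)
open import Relation.Binary.PropositionalEquality
  using (_≡_; refl; sym; trans; cong; cong₂; subst; module ≡-Reasoning)
open ≡-Reasoning
import Data.Nat.Properties as ℕP
import Data.Integer.Properties as ℤP
open import Data.Integer.Tactic.RingSolver using (solve-∀)
open import Data.Nat.Tactic.RingSolver using () renaming (solve-∀ to solve-ℕ)

record Recurrent (X : ℕ → ℤ) : Set where
  constructor recurrent
  field step : ∀ k → X (suc (suc k)) ≡ + 6 * X (suc k) - X k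
open Recurrent

recurrent-unique : ∀ {X Y} → Recurrent X → Recurrent Y →
  X 0 ≡ Y 0 → X 1 ≡ Y 1 → ∀ k → X k ≡ Y k
recurrent-unique {X} {Y} rX rY e₀ e₁ = agree
  where
  agree : ∀ k → X k ≡ Y k
  agree zero = e₀
  agree (suc zero) = e₁
  agree (suc (suc k)) = begin
    X (suc (suc k))               ≡⟨ step rX k ⟩
    + 6 * X (suc k) - X k         ≡⟨ cong₂ (λ u v → + 6 * u - v) (agree (suc k)) (agree k) ⟩
    + 6 * Y (suc k) - Y k         ≡⟨ sym (step rY k) ⟩
    Y (suc (suc k))               ∎

recurrent-shift : ∀ {X} t → Recurrent X → Recurrent (λ k → X (k +ℕ t))
recurrent-shift t rX = recurrent λ k → step rX (k +ℕ t)

recurrent-tail : ∀ {X} → Recurrent X → Recurrent (λ k → X (suc k))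
recurrent-tail rX = recurrent λ k → step rX (suc k)

recurrent-scale : ∀ {X} p → Recurrent X → Recurrent (λ k → p * X k)
recurrent-scale {X} p rX = recurrent λ k →
  trans (cong (p *_) (step rX k)) (identity p (X (suc k)) (X k))
  where
  identity : ∀ p x₁ x₀ → p * (+ 6 * x₁ - x₀) ≡ + 6 * (p * x₁) - p * x₀
  identity = solve-∀

recurrent-sub : ∀ {X Y} → Recurrent X → Recurrent Y → Recurrent (λ k → X k - Y k)
recurrent-sub {X} {Y} rX rY = recurrent λ k →
  trans (cong₂ _-_ (step rX k) (step rY k)) (identity (X (suc k)) (X k) (Y (suc k)) (Y k))
  where
  identity : ∀ x₁ x₀ y₁ y₀ →
    (+ 6 * x₁ - x₀) - (+ 6 * y₁ - y₀) ≡ + 6 * (x₁ - y₁) - (x₀ - y₀)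
  identity = solve-∀

recurrent-backward : ∀ {X} → Recurrent X → ∀ k → X k ≡ + 6 * X (suc k) - X (suc (suc k))
recurrent-backward {X} rX k =
  trans (identity (X (suc k)) (X k)) (cong (λ u → + 6 * X (suc k) - u) (sym (step rX k)))
  where
  identity : ∀ x₁ x₀ → x₀ ≡ + 6 * x₁ - (+ 6 * x₁ - x₀)
  identity = solve-∀

-- Δ X k = 2 (X (k+1) - 3 X k); for a recurrent X this is X (k+1) - X (k-1),
-- but it is defined at k = 0 as well.
Δ : (ℕ → ℤ) → ℕ → ℤ
Δ X k = + 2 * (X (suc k) - + 3 * X k)

recurrent-Δ : ∀ {X} → Recurrent X → Recurrent (Δ X)
recurrent-Δ rX = recurrent-scale (+ 2) (recurrent-sub (recurrent-tail rX) (recurrent-scale (+ 3) rX))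

B-recurrent : Recurrent B
B-recurrent = recurrent λ k → refl

c-tail-recurrent : Recurrent (λ k → c (suc k))
c-tail-recurrent = recurrent λ k → refl

even-difference : ∀ {X} → Recurrent X →
  ∀ m a → X (m +ℕ (m +ℕ a)) - X a ≡ B m * Δ X (m +ℕ a)
even-difference {X} rX zero a = identity (X a) (Δ X a)
  where
  identity : ∀ x d → x - x ≡ + 0 * d
  identity = solve-∀
even-difference {X} rX (suc zero) a =
  trans (cong (X (suc (suc a)) -_) (recurrent-backward rX a))
        (identity (X (suc (suc a))) (X (suc a)))
  where
  identity : ∀ x₂ x₁ → x₂ - (+ 6 * x₁ - x₂) ≡ + 1 * (+ 2 * (x₂ - + 3 * x₁))
  identity = solve-∀
-- Half-length m + 2 follows from half-lengths m + 1 and m about the same centre,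
-- since the tops and the bottoms both obey the recurrence and B (m+2) = 6 B (m+1) - B m.
even-difference {X} rX (suc (suc m)) a = begin
  X (suc (suc m) +ℕ (suc (suc m) +ℕ a)) - X a
    ≡⟨ cong₂ _-_ top-recurrence (recurrent-backward rX a) ⟩
  (+ 6 * X top₁ - X top₂) - (+ 6 * X (suc a) - X (suc (suc a)))
    ≡⟨ regroup (X top₁) (X top₂) (X (suc a)) (X (suc (suc a))) ⟩
  + 6 * (X top₁ - X (suc a)) - (X top₂ - X (suc (suc a)))
    ≡⟨ cong₂ (λ u v → + 6 * u - v) (wider (even-difference rX (suc m) (suc a)))
                                    (narrower (even-difference rX m (suc (suc a)))) ⟩
  + 6 * (B (suc m) * d) - B m * d
    ≡⟨ factor (B (suc m)) (B m) d ⟩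
  (+ 6 * B (suc m) - B m) * d ∎
  where
  centre₂ : m +ℕ suc (suc a) ≡ suc (suc (m +ℕ a))
  centre₂ = trans (ℕP.+-suc m (suc a)) (cong suc (ℕP.+-suc m a))
  centre₁ : suc m +ℕ suc a ≡ suc (suc (m +ℕ a))
  centre₁ = cong suc (ℕP.+-suc m a)
  top₁ top₂ : ℕ
  top₁ = suc m +ℕ (suc m +ℕ suc a)
  top₂ = m +ℕ (m +ℕ suc (suc a))
  d : ℤ
  d = Δ X (suc (suc (m +ℕ a)))
  wider : X top₁ - X (suc a) ≡ B (suc m) * Δ X (suc m +ℕ suc a) →
          X top₁ - X (suc a) ≡ B (suc m) * d
  wider = subst (λ k → X top₁ - X (suc a) ≡ B (suc m) * Δ X k) centre₁
  narrower : X top₂ - X (suc (suc a)) ≡ B m * Δ X (m +ℕ suc (suc a)) →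
             X top₂ - X (suc (suc a)) ≡ B m * d
  narrower = subst (λ k → X top₂ - X (suc (suc a)) ≡ B m * Δ X k) centre₂
  top-recurrence : X (suc (suc m) +ℕ (suc (suc m) +ℕ a))
    ≡ + 6 * X top₁ - X top₂
  top-recurrence = trans (step rX (m +ℕ suc (suc (m +ℕ a))))
    (cong₂ (λ i j → + 6 * X i - X j)
           (cong (λ k → suc (m +ℕ k)) (sym centre₁)) (cong (m +ℕ_) (sym centre₂)))
  regroup : ∀ t₁ t₂ l₁ l₂ → (+ 6 * t₁ - t₂) - (+ 6 * l₁ - l₂) ≡ + 6 * (t₁ - l₁) - (t₂ - l₂)
  regroup = solve-∀
  factor : ∀ p q d → + 6 * (p * d) - q * d ≡ (+ 6 * p - q) * d
  factor = solve-∀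

-- D k = 2 b k + 1 turns the inhomogeneous cobalancing recurrence into the
-- balancing one; note D 0 = D 1 = 1.
D : ℕ → ℤ
D k = + 2 * b k + + 1

D-recurrent : Recurrent D
D-recurrent = recurrent D-step
  where
  identity : ∀ x y → + 2 * (+ 6 * x - y + + 2) + + 1 ≡ + 6 * (+ 2 * x + + 1) - (+ 2 * y + + 1)
  identity = solve-∀
  D-step : ∀ k → D (suc (suc k)) ≡ + 6 * D (suc k) - D k
  D-step zero = refl
  D-step (suc k) = identity (b (suc (suc k))) (b (suc k))

-- D (n+1) - D (n-1) = 4 c n: both sides are recurrent in n ≥ 1 with values 4, 28.
Δ-D : ∀ n → 1 ≤ n → Δ D n ≡ + 4 * c n
Δ-D (suc n) _ =
  recurrent-unique (recurrent-tail (recurrent-Δ D-recurrent)) (recurrent-scale (+ 4) c-tail-recurrent)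
    refl refl n

D-even-centred : ∀ m a → 1 ≤ m +ℕ a → D (m +ℕ (m +ℕ a)) - D a ≡ + 4 * c (m +ℕ a) * B m
D-even-centred m a 1≤k = begin
  D (m +ℕ (m +ℕ a)) - D a       ≡⟨ even-difference D-recurrent m a ⟩
  B m * Δ D (m +ℕ a)            ≡⟨ cong (B m *_) (Δ-D (m +ℕ a) 1≤k) ⟩
  B m * (+ 4 * c (m +ℕ a))      ≡⟨ ℤP.*-comm (B m) (+ 4 * c (m +ℕ a)) ⟩
  + 4 * c (m +ℕ a) * B m        ∎

D-even : ∀ n m → m ≤ n → 1 ≤ n → D (n +ℕ m) - D (n ∸ m) ≡ + 4 * c n * B m
D-even n m m≤n 1≤n with ℕP.m≤n⇒∃[o]m+o≡n m≤n
... | a , refl = begin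
  D (m +ℕ a +ℕ m) - D (m +ℕ a ∸ m)
    ≡⟨ cong₂ (λ i j → D i - D j) (ℕP.+-comm (m +ℕ a) m) (ℕP.m+n∸m≡n m a) ⟩
  D (m +ℕ (m +ℕ a)) - D a
    ≡⟨ D-even-centred m a 1≤n ⟩
  + 4 * c (m +ℕ a) * B m ∎

-- Odd differences of D: for n = n' + 1 and every a,
-- D (a + 2n - 1) - D a = 4 c n B (a + n - 1).  Both sides are recurrent in a;
-- at a = 0 and a = 1 this is an even difference, since D 0 = D 1.
D-odd-shifted : ∀ n' a → D (a +ℕ (n' +ℕ suc n')) - D a ≡ + 4 * c (suc n') * B (a +ℕ n')
D-odd-shifted n' = recurrent-unique
  (recurrent-sub (recurrent-shift (n' +ℕ suc n') D-recurrent) D-recurrent)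
  (recurrent-scale (+ 4 * c (suc n')) (recurrent-shift n' B-recurrent))
  at-zero at-one
  where
  at-zero : D (n' +ℕ suc n') - D 1 ≡ + 4 * c (suc n') * B n'
  at-zero = subst (λ k → D (n' +ℕ k) - D 1 ≡ + 4 * c k * B n') (ℕP.+-comm n' 1)
                  (D-even-centred n' 1 (ℕP.m≤n+m 1 n'))
  at-one : D (suc n' +ℕ suc n') - D 0 ≡ + 4 * c (suc n') * B (suc n')
  at-one = subst (λ k → D (suc n' +ℕ k) - D 0 ≡ + 4 * c k * B (suc n')) (ℕP.+-identityʳ (suc n'))
                 (D-even-centred (suc n') 0 (s≤s z≤n))

D-odd : ∀ n m → n ≤ m → 1 ≤ n → D (n +ℕ m) - D ((m ∸ n) +ℕ 1) ≡ + 4 * c n * B m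
D-odd (suc n') m n≤m _ with ℕP.m≤n⇒∃[o]m+o≡n n≤m
... | j , refl = begin
  D (suc n' +ℕ (suc n' +ℕ j)) - D ((suc n' +ℕ j ∸ suc n') +ℕ 1)
    ≡⟨ cong₂ (λ i k → D i - D k) (top j) (low j) ⟩
  D (suc j +ℕ (n' +ℕ suc n')) - D (suc j)
    ≡⟨ D-odd-shifted n' (suc j) ⟩
  + 4 * c (suc n') * B (suc j +ℕ n')
    ≡⟨ cong (λ i → + 4 * c (suc n') * B i) (trans (sym (ℕP.+-suc j n')) (ℕP.+-comm j (suc n'))) ⟩
  + 4 * c (suc n') * B (suc n' +ℕ j) ∎
  where
  top : ∀ i → suc n' +ℕ (suc n' +ℕ i) ≡ suc i +ℕ (n' +ℕ suc n')
  top = solve-ℕ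
  low : ∀ i → (suc n' +ℕ i ∸ suc n') +ℕ 1 ≡ suc i
  low i = trans (cong (_+ℕ 1) (ℕP.m+n∸m≡n (suc n') i)) (ℕP.+-comm i 1)

b-from-D : ∀ i j x y → D i - D j ≡ + 4 * x * y → b i - b j ≡ + 2 * x * y
b-from-D i j x y h = ℤP.*-cancelˡ-≡ (+ 2) (b i - b j) (+ 2 * x * y) (begin
  + 2 * (b i - b j)   ≡⟨ double (b i) (b j) ⟩
  D i - D j           ≡⟨ h ⟩
  + 4 * x * y         ≡⟨ halve x y ⟩
  + 2 * (+ 2 * x * y) ∎)
  where
  double : ∀ u v → + 2 * (u - v) ≡ (+ 2 * u + + 1) - (+ 2 * v + + 1)
  double = solve-∀
  halve : ∀ x y → + 4 * x * y ≡ + 2 * (+ 2 * x * y)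
  halve = solve-∀

-- Both parts are the D-identities halved.
mainTheorem6 : (n m : ℕ) → 1 ≤ n → 1 ≤ m →
    (m < n → b (n +ℕ m) - b (n ∸ m) ≡ + 2 * c n * B m) ×
    (n ≤ m → b (n +ℕ m) - b ((m ∸ n) +ℕ 1) ≡ + 2 * c n * B m)
mainTheorem6 n m 1≤n _ =
  (λ m<n → b-from-D (n +ℕ m) (n ∸ m) (c n) (B m) (D-even n m (ℕP.<⇒≤ m<n) 1≤n)) ,
  (λ n≤m → b-from-D (n +ℕ m) ((m ∸ n) +ℕ 1) (c n) (B m) (D-odd n m n≤m 1≤n))
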